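{- Let $m>0$. Let $2\le a\le b\le c$ and $2\le a'\le b'\le c'$ be integers with $c'=c-1$ such that $(F(a),F(b),F(c))$ and $(F(a'),F(b'),F(c'))$ are both minimal Markoff $m$-triples (for the same $m$). If $c\ge 11$, then $(a,a')\ne(2,2)$.
   Context: $F(n)$ denotes the $n$-th Fibonacci number, $F(0)=0$, $F(1)=1$, $F(n+1)=F(n)+F(n-1)$. A Markoff $m$-triple is a triple $(x,y,z)$ of positive integers with $x\le y\le z$ satisfying $x^2+y^2+z^2=3xyz+m$; it is minimal if $z\ge 3xy$. -}

module Defs where

open import Data.Nat using (ℕ; zero; suc; _+_; _*_; _≤_; _<_)
open import Data.Product using (_×_)
open import Relation.Binary.PropositionalEquality using (_≡_)

F : ℕ → ℕ
F zero = zero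
F (suc zero) = suc zero
F (suc (suc n)) = F (suc n) + F n

MarkoffTriple : ℕ → ℕ → ℕ → ℕ → Set
MarkoffTriple m x y z =
  (0 < x) × (x ≤ y) × (y ≤ z) ×
  (x * x + y * y + z * z ≡ 3 * x * y * z + m)

MinimalMarkoffTriple : ℕ → ℕ → ℕ → ℕ → Set
MinimalMarkoffTriple m x y z = MarkoffTriple m x y z × (3 * x * y ≤ z)

{-# OPTIONS --safe #-}
-- With a = a′ = 2 both triples are (1, y, z), whose m = 1 + y² + z² - 3yz decreases in y
-- for y ≤ z. Minimality 3 F b ≤ F c forces b ≤ c - 3. If b ≤ c - 4, then
-- m ≥ m(F (c - 4), F c) > m(1, F (c - 1)) ≥ m. If b = c - 3, then m = m(F (c - 3), F c)
-- lies strictly between m(F (c - 8), F (c - 1)) and m(F (c - 9), F (c - 1)), whereas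
-- b′ ≥ c - 8 gives m ≤ the former and b′ ≤ c - 9 gives m ≥ the latter.
-- The three strict inequalities hold for c ≥ 11 as polynomial inequalities in F (c - 11), F (c - 10).
module Submission where

open import Defs
open import Data.Nat using (ℕ; zero; suc; _+_; _*_; _∸_; _≤_; _<_; z≤n; s≤s; _≤?_)
open import Data.Nat.Properties
open import Data.Nat.Tactic.RingSolver using (solve-∀; solve)
open import Data.Product using (_×_; _,_)
open import Data.Sum using (inj₁; inj₂)
open import Data.Empty using (⊥)
open import Data.List using (_∷_; [])
open import Relation.Nullary using (¬_; yes; no)
open import Relation.Binary.PropositionalEquality
  using (_≡_; refl; sym; trans; cong; cong₂; subst; subst₂; module ≡-Reasoning)

F[n]≤F[1+n] : ∀ n → F n ≤ F (suc n)
F[n]≤F[1+n] zero = z≤n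
F[n]≤F[1+n] (suc n) = m≤m+n (F (suc n)) (F n)

F-mono : ∀ {i j} → i ≤ j → F i ≤ F j
F-mono i≤j with m≤n⇒m<n∨m≡n i≤j
... | inj₂ refl = ≤-refl
... | inj₁ (s≤s {n = j′} i≤j′) = ≤-trans (F-mono i≤j′) (F[n]≤F[1+n] j′)

F-pos : ∀ n → 0 < F (suc n)
F-pos n = F-mono {1} {suc n} (s≤s z≤n)

F-+ : ∀ m n → F (suc m + n) ≡ F (suc m) * F (suc n) + F m * F n
F-+ zero n = sym (trans (+-identityʳ _) (*-identityˡ (F (suc n))))
F-+ (suc zero) n = sym (cong₂ _+_ (*-identityˡ (F (suc n))) (*-identityˡ (F n)))
F-+ (suc (suc m)) n =
  trans (cong₂ _+_ (F-+ (suc m) n) (F-+ m n))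
        (regroup (F (suc (suc m))) (F (suc m)) (F m) (F (suc n)) (F n))
  where
  regroup : ∀ a b c x y → (a * x + b * y) + (b * x + c * y) ≡ (a + b) * x + (b + c) * y
  regroup = solve-∀

3*F[n]≤F[3+n] : ∀ n → 3 * F n ≤ F (3 + n)
3*F[n]≤F[3+n] zero = z≤n
3*F[n]≤F[3+n] (suc n) = subst (3 * F (suc n) ≤_) (sym (F-+ 3 n)) (m≤m+n _ _)

3*F≤F : ∀ {i j} → 3 + i ≤ j → 3 * F i ≤ F j
3*F≤F {i} 3+i≤j = ≤-trans (3*F[n]≤F[3+n] i) (F-mono 3+i≤j)

F[5+n]<3*F[3+n] : ∀ n → F (5 + n) < 3 * F (3 + n)
F[5+n]<3*F[3+n] n = subst (F (5 + n) <_) F[5+n]+F[1+n]≡3*F[3+n] (m<m+n _ (F-pos n))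
  where
  open ≡-Reasoning
  regroup : ∀ q p → (5 * q + 3 * p) + q ≡ 3 * (2 * q + 1 * p)
  regroup = solve-∀
  F[5+n]+F[1+n]≡3*F[3+n] : F (5 + n) + F (1 + n) ≡ 3 * F (3 + n)
  F[5+n]+F[1+n]≡3*F[3+n] = begin
    F (5 + n) + F (1 + n)                 ≡⟨ cong (_+ F (1 + n)) (F-+ 4 n) ⟩
    (5 * F (1 + n) + 3 * F n) + F (1 + n) ≡⟨ regroup (F (1 + n)) (F n) ⟩
    3 * (2 * F (1 + n) + 1 * F n)         ≡⟨ cong (3 *_) (F-+ 2 n) ⟨
    3 * F (3 + n)                         ∎

3*F≤F[5+n]⇒≤2+n : ∀ {i} n → 3 * F i ≤ F (5 + n) → i ≤ 2 + n
3*F≤F[5+n]⇒≤2+n n 3Fi≤ = ≮⇒≥ λ 2+n<i →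
  <⇒≱ (F[5+n]<3*F[3+n] n) (≤-trans (*-monoʳ-≤ 3 (F-mono 2+n<i)) 3Fi≤)

-- A record rather than a bare equation, so that m, y and z are inferable.
record Markoff₁ (m y z : ℕ) : Set where
  constructor mkMarkoff₁
  field equation : 1 + y * y + z * z ≡ 3 * y * z + m

-- Because ∸ truncates, this is the m of (1, y, z) only when 3 * y ≤ z.
markoff₁ : ℕ → ℕ → ℕ
markoff₁ y z = 1 + y * y + z * (z ∸ 3 * y)

markoff₁-value : ∀ {y z} → 3 * y ≤ z → Markoff₁ (markoff₁ y z) y z
markoff₁-value {y} 3y≤z with t , refl ← m≤n⇒∃[o]m+o≡n 3y≤z
  rewrite m+n∸m≡n (3 * y) t = mkMarkoff₁ (expand y t)
  where
  expand : ∀ y t → 1 + y * y + (3 * y + t) * (3 * y + t)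
                 ≡ 3 * y * (3 * y + t) + (1 + y * y + (3 * y + t) * t)
  expand = solve-∀

markoff₁-gap : ∀ {m₀ y₀ z₀ m₁ y₁ z₁ e d} → Markoff₁ m₀ y₀ z₀ → Markoff₁ m₁ y₁ z₁ →
  3 * y₁ * z₁ + (1 + y₀ * y₀ + z₀ * z₀) + e ≡ 3 * y₀ * z₀ + (1 + y₁ * y₁ + z₁ * z₁) + d →
  m₀ + e ≡ m₁ + d
markoff₁-gap {m₀} {y₀} {z₀} {m₁} {y₁} {z₁} {e} {d} (mkMarkoff₁ eq₀) (mkMarkoff₁ eq₁) identity =
  +-cancelˡ-≡ (3 * y₀ * z₀ + 3 * y₁ * z₁) _ _ (begin
    (3 * y₀ * z₀ + 3 * y₁ * z₁) + (m₀ + e)      ≡⟨ solve (y₀ ∷ z₀ ∷ y₁ ∷ z₁ ∷ m₀ ∷ e ∷ []) ⟩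
    3 * y₁ * z₁ + (3 * y₀ * z₀ + m₀) + e        ≡⟨ cong (λ n → 3 * y₁ * z₁ + n + e) eq₀ ⟨
    3 * y₁ * z₁ + (1 + y₀ * y₀ + z₀ * z₀) + e   ≡⟨ identity ⟩
    3 * y₀ * z₀ + (1 + y₁ * y₁ + z₁ * z₁) + d   ≡⟨ cong (λ n → 3 * y₀ * z₀ + n + d) eq₁ ⟩
    3 * y₀ * z₀ + (3 * y₁ * z₁ + m₁) + d        ≡⟨ solve (y₀ ∷ z₀ ∷ y₁ ∷ z₁ ∷ m₁ ∷ d ∷ []) ⟩
    (3 * y₀ * z₀ + 3 * y₁ * z₁) + (m₁ + d)      ∎)
  where open ≡-Reasoning

markoff₁-< : ∀ {m₀ y₀ z₀ m₁ y₁ z₁} e d → Markoff₁ m₀ y₀ z₀ → Markoff₁ m₁ y₁ z₁ →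
  3 * y₁ * z₁ + (1 + y₀ * y₀ + z₀ * z₀) + e ≡ 3 * y₀ * z₀ + (1 + y₁ * y₁ + z₁ * z₁) + d →
  e < d → m₁ < m₀
markoff₁-< {m₀} {m₁ = m₁} e d eq₀ eq₁ identity e<d =
  +-cancelʳ-< e m₁ m₀ (subst (m₁ + e <_) (sym (markoff₁-gap eq₀ eq₁ identity)) (+-monoʳ-< m₁ e<d))

-- m₁ - m₂ = (y₂ - y₁) (3z - y₁ - y₂)
markoff₁-antitone : ∀ {m₁ m₂ y₁ y₂ z} → y₁ ≤ y₂ → y₂ ≤ z →
  Markoff₁ m₁ y₁ z → Markoff₁ m₂ y₂ z → m₂ ≤ m₁
markoff₁-antitone {m₁} {m₂} {y₁} {y₂} {z} y₁≤y₂ y₂≤z eq₁ eq₂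
  with δ , refl ← m≤n⇒∃[o]m+o≡n y₁≤y₂
  with t , y₁+y₂+t≡3z ← m≤n⇒∃[o]m+o≡n (+-mono-≤ (≤-trans y₁≤y₂ y₂≤z) (≤-trans y₂≤z (m≤m+n z (z + 0))))
  = subst (m₂ ≤_) (trans (sym (markoff₁-gap eq₁ eq₂ identity)) (+-identityʳ m₁)) (m≤m+n m₂ (δ * t))
  where
  open ≡-Reasoning
  identity : 3 * (y₁ + δ) * z + (1 + y₁ * y₁ + z * z) + 0
           ≡ 3 * y₁ * z + (1 + (y₁ + δ) * (y₁ + δ) + z * z) + δ * t
  identity = begin
    3 * (y₁ + δ) * z + (1 + y₁ * y₁ + z * z) + 0
      ≡⟨ solve (y₁ ∷ δ ∷ z ∷ []) ⟩
    3 * y₁ * z + (1 + y₁ * y₁ + z * z) + δ * (3 * z)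
      ≡⟨ cong (λ w → 3 * y₁ * z + (1 + y₁ * y₁ + z * z) + δ * w) y₁+y₂+t≡3z ⟨
    3 * y₁ * z + (1 + y₁ * y₁ + z * z) + δ * (y₁ + (y₁ + δ) + t)
      ≡⟨ solve (y₁ ∷ δ ∷ z ∷ t ∷ []) ⟩
    3 * y₁ * z + (1 + (y₁ + δ) * (y₁ + δ) + z * z) + δ * t ∎

markoff₁-lowerBound : ∀ {m y y′ z} → y ≤ y′ → 3 * y′ ≤ z → Markoff₁ m y z → markoff₁ y′ z ≤ m
markoff₁-lowerBound {y′ = y′} y≤y′ 3y′≤z eq =
  markoff₁-antitone y≤y′ (≤-trans (m≤n*m y′ 3) 3y′≤z) eq (markoff₁-value 3y′≤z)

markoff₁-upperBound : ∀ {m y y′ z} → y′ ≤ y → 3 * y ≤ z → Markoff₁ m y z → m ≤ markoff₁ y′ z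
markoff₁-upperBound {y = y} y′≤y 3y≤z eq =
  markoff₁-antitone y′≤y (≤-trans (m≤n*m y 3) 3y≤z) (markoff₁-value (≤-trans (*-monoʳ-≤ 3 y′≤y) 3y≤z)) eq

-- Write p = F k and q = F (1 + k). By F-+, F (j + k) is the linear form F j * q + F (j - 1) * p,
-- so comparing two m's is a polynomial inequality in p and q; it is proved by writing
-- m₀ - m₁ = d - e with d, e polynomials with nonnegative coefficients.
-- In the names below, Fj stands for F (j + k).
markoff₁-value-F : ∀ {i j} k → 3 + i ≤ j →
  Markoff₁ (markoff₁ (F (suc i + k)) (F (suc j + k)))
           (F (suc i) * F (suc k) + F i * F k) (F (suc j) * F (suc k) + F j * F k)
markoff₁-value-F {i} {j} k 3+i≤j =
  subst₂ (Markoff₁ _) (F-+ i k) (F-+ j k) (markoff₁-value (3*F≤F (+-monoˡ-≤ k (s≤s 3+i≤j))))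

m[1,F10]<m[F7,F11] : ∀ k → markoff₁ 1 (F (10 + k)) < markoff₁ (F (7 + k)) (F (11 + k))
m[1,F10]<m[F7,F11] k = linear {F k} {F (suc k)} (F-pos k)
  (markoff₁-value-F {6} {10} k (n≤1+n 9))
  (subst (Markoff₁ _ 1) (F-+ 9 k) (markoff₁-value (3*F≤F {2} {10 + k} (m≤m+n 5 (5 + k)))))
  where
  linear : ∀ {p q m₀ m₁} → 0 < q →
    Markoff₁ m₀ (13 * q + 8 * p) (89 * q + 55 * p) → Markoff₁ m₁ 1 (55 * q + 34 * p) → m₁ < m₀
  linear {p} {q} 0<q eq₀ eq₁ =
    markoff₁-< 1 (2 * (q * q) + (1592 * (q * q) + 1977 * (p * q) + 613 * (p * p) + 165 * q + 102 * p))
      eq₀ eq₁ (solve (p ∷ q ∷ [])) (≤-trans (*-monoʳ-≤ 2 (*-mono-< 0<q 0<q)) (m≤m+n _ _))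

m[F3,F10]<m[F8,F11] : ∀ k → markoff₁ (F (3 + k)) (F (10 + k)) < markoff₁ (F (8 + k)) (F (11 + k))
m[F3,F10]<m[F8,F11] k = linear {F k} {F (suc k)} (F-pos k) (F[n]≤F[1+n] k)
  (markoff₁-value-F {7} {10} k ≤-refl) (markoff₁-value-F {2} {9} k (m≤m+n 5 4))
  where
  linear : ∀ {p q m₀ m₁} → 0 < q → p ≤ q →
    Markoff₁ m₀ (21 * q + 13 * p) (89 * q + 55 * p) → Markoff₁ m₁ (2 * q + 1 * p) (55 * q + 34 * p) → m₁ < m₀
  linear {p} {q} 0<q p≤q eq₀ eq₁ =
    markoff₁-< (6 * (p * p)) (6 * (q * q) + (q * q + (49 * (q * q) + 25 * (p * q))))
      eq₀ eq₁ (solve (p ∷ q ∷ []))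
      (≤-<-trans (*-monoʳ-≤ 6 (*-mono-≤ p≤q p≤q)) (m<m+n _ (≤-trans (*-mono-< 0<q 0<q) (m≤m+n _ _))))

m[F8,F11]<m[F2,F10] : ∀ k → markoff₁ (F (8 + k)) (F (11 + k)) < markoff₁ (F (2 + k)) (F (10 + k))
m[F8,F11]<m[F2,F10] k = linear {F k} {F (suc k)} (F-pos k)
  (markoff₁-value-F {1} {9} k (m≤m+n 4 5)) (markoff₁-value-F {7} {10} k ≤-refl)
  where
  linear : ∀ {p q m₀ m₁} → 0 < q →
    Markoff₁ m₀ (1 * q + 1 * p) (55 * q + 34 * p) → Markoff₁ m₁ (21 * q + 13 * p) (89 * q + 55 * p) → m₁ < m₀
  linear {p} {q} 0<q eq₀ eq₁ =
    markoff₁-< 0 (q * q + (105 * (q * q) + 75 * (p * q) + 6 * (p * p)))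
      eq₀ eq₁ (solve (p ∷ q ∷ [])) (≤-trans (*-mono-< 0<q 0<q) (m≤m+n _ _))

no-consecutive-minimal-pair-with-x≡1 : ∀ k {m b b′} →
  Markoff₁ m (F b) (F (11 + k)) → 3 * F b ≤ F (11 + k) →
  Markoff₁ m (F b′) (F (10 + k)) → 2 ≤ b′ → 3 * F b′ ≤ F (10 + k) → ⊥
no-consecutive-minimal-pair-with-x≡1 k {b = b} {b′} eq 3Fb≤ eq′ 2≤b′ 3Fb′≤ with b ≤? 7 + k
... | yes b≤7+k = <⇒≱ (m[1,F10]<m[F7,F11] k)
  (≤-trans (markoff₁-lowerBound (F-mono b≤7+k) (3*F≤F (n≤1+n (10 + k))) eq)
           (markoff₁-upperBound (F-mono 2≤b′) 3Fb′≤ eq′))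
... | no b≰7+k with b′ ≤? 2 + k
...   | yes b′≤2+k = <⇒≱ (m[F8,F11]<m[F2,F10] k)
  (≤-trans (markoff₁-lowerBound (F-mono b′≤2+k) (3*F≤F (m≤n+m (5 + k) 5)) eq′)
           (markoff₁-upperBound (F-mono (≰⇒> b≰7+k)) 3Fb≤ eq))
...   | no b′≰2+k = <⇒≱ (m[F3,F10]<m[F8,F11] k)
  (≤-trans (markoff₁-lowerBound (F-mono (3*F≤F[5+n]⇒≤2+n {b} (6 + k) 3Fb≤)) (3*F≤F {8 + k} ≤-refl) eq)
           (markoff₁-upperBound (F-mono (≰⇒> b′≰2+k)) 3Fb′≤ eq′))

lemma4p14 : (m a b c a′ b′ c′ : ℕ) → 0 < m →
    2 ≤ a → a ≤ b → b ≤ c → 2 ≤ a′ → a′ ≤ b′ → b′ ≤ c′ →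
    c′ ≡ c ∸ 1 →
    MinimalMarkoffTriple m (F a) (F b) (F c) →
    MinimalMarkoffTriple m (F a′) (F b′) (F c′) →
    11 ≤ c →
    ¬ (a ≡ 2 × a′ ≡ 2)
lemma4p14 m a b c a′ b′ c′ _ _ _ _ _ a′≤b′ _ refl
  ((_ , _ , _ , eq) , 3Fb≤Fc) ((_ , _ , _ , eq′) , 3Fb′≤Fc′) 11≤c (refl , refl)
  with k , refl ← m≤n⇒∃[o]m+o≡n 11≤c =
  no-consecutive-minimal-pair-with-x≡1 k {m} {b} {b′}
    (mkMarkoff₁ eq) 3Fb≤Fc (mkMarkoff₁ eq′) a′≤b′ 3Fb′≤Fc′
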